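{- For any primes $q$ and $p$ with $q\mid p-1$, the number $\frac{1}{q-1}\binom{q+p-2}{p}$ is an integer and \[ \frac{1}{q-1}\binom{q+p-2}{p} \equiv 1 \pmod q.\] -}

module Defs where

-- The absorption identity p·C(n, p) = (q − 1)·C(n, p − 1) for n = q + p − 2, together with
-- p ∤ q − 1, shows that p divides C(n, p − 1) = C(n, q − 1); the quotient m then satisfies
-- (q − 1)·m = C(n, p). Writing p − 1 = t·q, the product formula
-- (q − 1)!·C(tq + q − 1, q − 1) = (tq + 1)⋯(tq + q − 1) ≡ (q − 1)! (mod q) and q ∤ (q − 1)!
-- give C(n, q − 1) ≡ 1 (mod q); as p ≡ 1 (mod q), also m ≡ 1 (mod q).
module Submission where

open import Defs
open import Data.Nat using (ℕ; _+_; _*_; _∸_; NonZero)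
open import Data.Nat.DivMod using (_%_)
open import Data.Nat.Divisibility using (_∣_)
open import Data.Nat.Primality using (Prime)
open import Data.Nat.Combinatorics using (_C_)
open import Data.Product using (∃-syntax; _×_)
open import Relation.Binary.PropositionalEquality using (_≡_)

open import Data.Nat.Base using (zero; suc; _<_; _!; nonTrivial⇒n>1)
open import Data.Nat.Properties
open import Data.Nat.DivMod using ([m+kn]%n≡m%n)
open import Data.Nat.Divisibility using (divides; _∤_; _∣0; ∣⇒≤; >⇒∤)
open import Data.Nat.Primality using (euclidsLemma; prime⇒nonTrivial; prime⇒nonZero; ¬prime[0]; ¬prime[1])
open import Data.Nat.Combinatorics using (nCk+nC[k+1]≡[n+1]C[k+1]; nCk≡nC[n∸k]; nC1≡n)
open import Data.Nat.Solver using (module +-*-Solver)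
open +-*-Solver using (solve; _:+_; _:*_; _:=_; con)
open import Data.Product using (_,_)
open import Data.Sum using (inj₁; inj₂)
open import Relation.Nullary using (contradiction)
open import Relation.Binary.PropositionalEquality using (refl; sym; trans; cong; cong₂; subst; module ≡-Reasoning)

[1+k]*[1+n]C[1+k]≡[1+n]*nCk : ∀ n k → suc k * (suc n C suc k) ≡ suc n * (n C k)
[1+k]*[1+n]C[1+k]≡[1+n]*nCk zero    zero    = refl
[1+k]*[1+n]C[1+k]≡[1+n]*nCk zero    (suc k) = *-zeroʳ (suc (suc k))
[1+k]*[1+n]C[1+k]≡[1+n]*nCk (suc n) zero    = trans (+-identityʳ _) (trans (nC1≡n (suc (suc n))) (sym (*-identityʳ _)))
[1+k]*[1+n]C[1+k]≡[1+n]*nCk (suc n) (suc k) = begin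
  suc (suc k) * (suc (suc n) C suc (suc k))
                                      ≡⟨ cong (suc (suc k) *_) (nCk+nC[k+1]≡[n+1]C[k+1] (suc n) (suc k)) ⟨
  suc (suc k) * (a + b)               ≡⟨ regroup k a b ⟩
  a + (suc k * a + suc (suc k) * b)   ≡⟨ cong (a +_) (cong₂ _+_ ([1+k]*[1+n]C[1+k]≡[1+n]*nCk n k)
                                                                ([1+k]*[1+n]C[1+k]≡[1+n]*nCk n (suc k))) ⟩
  a + (suc n * c + suc n * d)         ≡⟨ cong (a +_) (*-distribˡ-+ (suc n) c d) ⟨
  a + suc n * (c + d)                 ≡⟨ cong (λ x → a + suc n * x) (nCk+nC[k+1]≡[n+1]C[k+1] n k) ⟩
  a + suc n * a                       ∎
  where
  open ≡-Reasoning
  a = suc n C suc k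
  b = suc n C suc (suc k)
  c = n C k
  d = n C suc k
  regroup : ∀ k a b → suc (suc k) * (a + b) ≡ a + (suc k * a + suc (suc k) * b)
  regroup = solve 3 (λ k a b → (con 2 :+ k) :* (a :+ b) := a :+ ((con 1 :+ k) :* a :+ (con 2 :+ k) :* b)) refl

[1+k]*[k+m]C[1+k]≡m*[k+m]Ck : ∀ k m → suc k * ((k + m) C suc k) ≡ m * ((k + m) C k)
[1+k]*[k+m]C[1+k]≡m*[k+m]Ck k m = +-cancelˡ-≡ (suc k * c) _ _ (begin
  suc k * c + suc k * (n C suc k)     ≡⟨ *-distribˡ-+ (suc k) c (n C suc k) ⟨
  suc k * (c + n C suc k)             ≡⟨ cong (suc k *_) (nCk+nC[k+1]≡[n+1]C[k+1] n k) ⟩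
  suc k * (suc n C suc k)             ≡⟨ [1+k]*[1+n]C[1+k]≡[1+n]*nCk n k ⟩
  (suc k + m) * c                     ≡⟨ *-distribʳ-+ c (suc k) m ⟩
  suc k * c + m * c                   ∎)
  where
  open ≡-Reasoning
  n = k + m
  c = n C k

[k+m]Ck≡[k+m]Cm : ∀ k m → (k + m) C k ≡ (k + m) C m
[k+m]Ck≡[k+m]Cm k m = trans (nCk≡nC[n∸k] (m≤m+n k m)) (cong ((k + m) C_) (m+n∸m≡n k m))

rising : ℕ → ℕ → ℕ
rising N zero    = 1
rising N (suc r) = (N + suc r) * rising N r

rising0≡! : ∀ r → rising 0 r ≡ r !
rising0≡! zero    = refl
rising0≡! (suc r) = cong (suc r *_) (rising0≡! r)

r!*[N+r]Cr≡rising : ∀ N r → r ! * ((N + r) C r) ≡ rising N r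
r!*[N+r]Cr≡rising N zero    = refl
r!*[N+r]Cr≡rising N (suc r) = begin
  suc r * r ! * ((N + suc r) C suc r)       ≡⟨ cong (λ n → suc r * r ! * (n C suc r)) (+-suc N r) ⟩
  suc r * r ! * (suc (N + r) C suc r)       ≡⟨ swap (suc r) (r !) _ ⟩
  r ! * (suc r * (suc (N + r) C suc r))     ≡⟨ cong (r ! *_) ([1+k]*[1+n]C[1+k]≡[1+n]*nCk (N + r) r) ⟩
  r ! * (suc (N + r) * ((N + r) C r))       ≡⟨ swap′ (r !) (suc (N + r)) _ ⟩
  suc (N + r) * (r ! * ((N + r) C r))       ≡⟨ cong₂ _*_ (sym (+-suc N r)) (r!*[N+r]Cr≡rising N r) ⟩
  (N + suc r) * rising N r                  ∎
  where
  open ≡-Reasoning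
  swap : ∀ a b c → a * b * c ≡ b * (a * c)
  swap = solve 3 (λ a b c → a :* b :* c := b :* (a :* c)) refl
  swap′ : ∀ a b c → a * (b * c) ≡ b * (a * c)
  swap′ = solve 3 (λ a b c → a :* (b :* c) := b :* (a :* c)) refl

rising[tq]r≡rising0r+cq : ∀ t q r → ∃[ c ] (rising (t * q) r ≡ rising 0 r + c * q)
rising[tq]r≡rising0r+cq t q zero    = 0 , refl
rising[tq]r≡rising0r+cq t q (suc r) with rising[tq]r≡rising0r+cq t q r
... | c , eq = t * rising 0 r + c * (t * q + suc r) , (begin
  (t * q + suc r) * rising (t * q) r        ≡⟨ cong ((t * q + suc r) *_) eq ⟩
  (t * q + suc r) * (rising 0 r + c * q)    ≡⟨ expand t q (suc r) (rising 0 r) c ⟩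
  suc r * rising 0 r + (t * rising 0 r + c * (t * q + suc r)) * q  ∎)
  where
  open ≡-Reasoning
  expand : ∀ t q s f c → (t * q + s) * (f + c * q) ≡ s * f + (t * f + c * (t * q + s)) * q
  expand = solve 5 (λ t q s f c → (t :* q :+ s) :* (f :+ c :* q)
                                := s :* f :+ (t :* f :+ c :* (t :* q :+ s)) :* q) refl

prime∧<⇒∤! : ∀ {p} r → Prime p → r < p → p ∤ r !
prime∧<⇒∤! {p} zero    pp _   = >⇒∤ (nonTrivial⇒n>1 p {{prime⇒nonTrivial pp}})
prime∧<⇒∤! {p} (suc r) pp r<p p∣r! with euclidsLemma (suc r) (r !) pp p∣r!
... | inj₁ p∣1+r = >⇒∤ r<p p∣1+r
... | inj₂ p∣r!  = prime∧<⇒∤! r pp (<-trans (n<1+n r) r<p) p∣r!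

prime∧∤∧a*y≡a+cq⇒y≡1+gq : ∀ {q a y c} → Prime q → q ∤ a → a * y ≡ a + c * q → ∃[ g ] (y ≡ 1 + g * q)
prime∧∤∧a*y≡a+cq⇒y≡1+gq {q} {a} {zero}  _  q∤a eq = contradiction (subst (q ∣_) (sym a≡0) (q ∣0)) q∤a
  where a≡0 = m+n≡0⇒m≡0 a (trans (sym eq) (*-zeroʳ a))
prime∧∤∧a*y≡a+cq⇒y≡1+gq {q} {a} {suc e} {c} pq q∤a eq
  with euclidsLemma a e pq (divides c (+-cancelˡ-≡ a _ _ (trans (sym (*-suc a e)) eq)))
... | inj₁ q∣a             = contradiction q∣a q∤a
... | inj₂ (divides g e≡gq) = g , cong suc e≡gq

[tq+r]Cr≡1+gq : ∀ {q} t r → Prime q → r < q → ∃[ g ] ((t * q + r) C r ≡ 1 + g * q)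
[tq+r]Cr≡1+gq {q} t r pq r<q with rising[tq]r≡rising0r+cq t q r
... | c , eq = prime∧∤∧a*y≡a+cq⇒y≡1+gq {c = c} pq (prime∧<⇒∤! r pq r<q)
  (trans (r!*[N+r]Cr≡rising (t * q) r) (subst (λ f → rising (t * q) r ≡ f + c * q) (rising0≡! r) eq))

prime∧∤∧p*b≡a*c⇒b≡a*x : ∀ {p a b c} → Prime p → p ∤ a → p * b ≡ a * c → ∃[ x ] (b ≡ a * x × c ≡ x * p)
prime∧∤∧p*b≡a*c⇒b≡a*x {p} {a} {b} {c} pp p∤a eq
  with euclidsLemma a c pp (divides b (trans (sym eq) (*-comm p b)))
... | inj₁ p∣a              = contradiction p∣a p∤a
... | inj₂ (divides x c≡xp) = x , *-cancelˡ-≡ b (a * x) p {{prime⇒nonZero pp}} (begin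
  p * b        ≡⟨ eq ⟩
  a * c        ≡⟨ cong (a *_) c≡xp ⟩
  a * (x * p)  ≡⟨ rotate a x p ⟩
  p * (a * x)  ∎) , c≡xp
  where
  open ≡-Reasoning
  rotate : ∀ a x p → a * (x * p) ≡ p * (a * x)
  rotate = solve 3 (λ a x p → a :* (x :* p) := p :* (a :* x)) refl

q∣k∧x*[1+k]≡1+gq⇒x%q≡1%q : ∀ {q k x g} .{{_ : NonZero q}} → q ∣ k → x * suc k ≡ 1 + g * q → x % q ≡ 1 % q
q∣k∧x*[1+k]≡1+gq⇒x%q≡1%q {q} {k} {x} {g} (divides t k≡tq) eq = begin
  x % q                  ≡⟨ [m+kn]%n≡m%n x (x * t) q ⟨
  (x + x * t * q) % q    ≡⟨ cong (_% q) (begin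
    x + x * t * q          ≡⟨ solve 3 (λ x t q → x :+ x :* t :* q := x :* (con 1 :+ t :* q)) refl x t q ⟩
    x * suc (t * q)        ≡⟨ cong (λ k → x * suc k) k≡tq ⟨
    x * suc k              ≡⟨ eq ⟩
    1 + g * q              ∎) ⟩
  (1 + g * q) % q        ≡⟨ [m+kn]%n≡m%n 1 g q ⟩
  1 % q                  ∎
  where open ≡-Reasoning

corollary4 : (q p : ℕ) → .{{_ : NonZero q}} → Prime q → Prime p → q ∣ p ∸ 1 →
    ∃[ m ] ((q ∸ 1) * m ≡ (q + p ∸ 2) C p × m % q ≡ 1 % q)
corollary4 q zero          _  pp _ = contradiction pp ¬prime[0]
corollary4 q (suc zero)    _  pp _ = contradiction pp ¬prime[1]
corollary4 (suc zero) p    pq _  _ = contradiction pq ¬prime[1]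
corollary4 q@(suc m@(suc _)) p@(suc k@(suc _)) pq pp q∣k@(divides t k≡tq)
  with prime∧∤∧p*b≡a*c⇒b≡a*x pp (>⇒∤ m<p) ([1+k]*[k+m]C[1+k]≡m*[k+m]Ck k m)
  where
  m<p : m < p
  m<p = m≤n⇒m≤1+n (∣⇒≤ q∣k)
... | x , [k+m]Cp≡m*x , [k+m]Ck≡x*p = x , trans (sym [k+m]Cp≡m*x) (cong (_C p) (sym n≡k+m)) , x≡1
  where
  n≡k+m : q + p ∸ 2 ≡ k + m
  n≡k+m = trans (cong (_∸ 1) (+-suc m k)) (+-comm m k)
  x≡1 : x % q ≡ 1 % q
  x≡1 with [tq+r]Cr≡1+gq t m pq ≤-refl
  ... | g , [tq+m]Cm≡1+gq = q∣k∧x*[1+k]≡1+gq⇒x%q≡1%q {x = x} {g = g} q∣k (begin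
    x * p            ≡⟨ [k+m]Ck≡x*p ⟨
    (k + m) C k      ≡⟨ [k+m]Ck≡[k+m]Cm k m ⟩
    (k + m) C m      ≡⟨ cong (λ k → (k + m) C m) k≡tq ⟩
    (t * q + m) C m  ≡⟨ [tq+m]Cm≡1+gq ⟩
    1 + g * q        ∎)
    where open ≡-Reasoning
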